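{- If the underlying graph of a signed graph $\Sigma$ has a cut containing more negative than positive edges, then $Q(\Sigma)<|E^-|$.
   Context: A signed graph $\Sigma=(\Gamma,\sigma)$ has $\Gamma=(V,E)$ and $\sigma:E\to\{+,-\}$; $E^-$ is the set of negative edges. A cut is a set $\partial X$ ($X\subseteq V$) of edges with exactly one endpoint in $X$. $\Sigma$ is clusterable if $V$ can be partitioned into sets (clusters) such that every edge within a cluster is positive and every edge between two clusters is negative; the inclusterability index $Q(\Sigma)$ is the smallest number of edges whose deletion leaves a clusterable signed graph. -}

module Defs where

open import Data.Nat using (ℕ; zero; suc; _+_; _≤_)
open import Data.Bool using (Bool; true; false; if_then_else_; _xor_)
open import Data.Fin using (Fin; zero; suc)
open import Data.Product using (_×_; _,_; proj₁; proj₂; ∃)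
open import Data.Fin.Subset using (Subset; _∈_; _∉_; ∣_∣)
open import Data.Vec using (lookup)
open import Relation.Binary.PropositionalEquality using (_≡_)
open import Function.Bundles using (_⇔_)

data Sign : Set where
  pos neg : Sign

isNeg : Sign → Bool
isNeg pos = false
isNeg neg = true

isPos : Sign → Bool
isPos pos = true
isPos neg = false

record SignedGraph : Set where
  field
    n    : ℕ
    m    : ℕ
    ends : Fin m → Fin n × Fin n
    sign : Fin m → Sign
open SignedGraph public

count : {k : ℕ} → (Fin k → Bool) → ℕ
count {zero}  p = 0
count {suc k} p = (if p zero then 1 else 0) + count (λ i → p (suc i))

numNeg : SignedGraph → ℕ
numNeg Σ = count (λ e → isNeg (sign Σ e))

inCut : (Σ : SignedGraph) → Subset (n Σ) → Fin (m Σ) → Bool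
inCut Σ X e = lookup X (proj₁ (ends Σ e)) xor lookup X (proj₂ (ends Σ e))

negInCut : (Σ : SignedGraph) → Subset (n Σ) → ℕ
negInCut Σ X = count (λ e → if inCut Σ X e then isNeg (sign Σ e) else false)

posInCut : (Σ : SignedGraph) → Subset (n Σ) → ℕ
posInCut Σ X = count (λ e → if inCut Σ X e then isPos (sign Σ e) else false)

-- The signed graph obtained by deleting the edge set D is clusterable:
-- there is a partition of V into clusters (given by a cluster label for each
-- vertex) such that every remaining edge is positive iff its endpoints lie in
-- the same cluster.
ClusterableAfterDeleting : (Σ : SignedGraph) → Subset (m Σ) → Set
ClusterableAfterDeleting Σ D =
  ∃ λ (cl : Fin (n Σ) → Fin (n Σ)) →
    ∀ (e : Fin (m Σ)) → e ∉ D →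
      (sign Σ e ≡ pos ⇔ cl (proj₁ (ends Σ e)) ≡ cl (proj₂ (ends Σ e)))

IsInclusterabilityIndex : SignedGraph → ℕ → Set
IsInclusterabilityIndex Σ q =
  (∃ λ (D : Subset (m Σ)) → ∣ D ∣ ≡ q × ClusterableAfterDeleting Σ D)
  × (∀ (D : Subset (m Σ)) → ClusterableAfterDeleting Σ D → q ≤ ∣ D ∣)

-- Let D consist of the positive edges of the cut ∂X and the negative edges
-- outside it. Deleting D leaves a graph clustered by the two clusters X and
-- V ∖ X, and |D| = |E⁻| − #neg(∂X) + #pos(∂X) < |E⁻| by hypothesis.
module Submission where

open import Defs
open import Data.Nat using (ℕ; _<_; zero; suc; _+_; z≤n)
open import Data.Nat.Properties
  using (≤-<-trans; +-cancelʳ-<; +-monoʳ-<; +-commutativeSemigroup)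
open import Algebra.Properties.CommutativeSemigroup +-commutativeSemigroup
  using (interchange)
open import Data.Bool using (Bool; true; false; if_then_else_; _xor_)
open import Data.Bool.Properties using (xor-same)
open import Data.Fin using (Fin; zero; suc)
open import Data.Fin.Subset using (Subset; _∉_; ∣_∣)
open import Data.Vec using (tabulate; lookup)
open import Data.Vec.Functional using (tail)
open import Data.Vec.Properties using (lookup∘tabulate; lookup⇒[]=)
open import Data.Product using (_,_; proj₁; proj₂; ∃)
open import Data.Empty using (⊥-elim)
open import Relation.Nullary using (¬_)
open import Relation.Binary.PropositionalEquality
open import Function.Bundles using (_⇔_; mk⇔)
open import Function.Properties.Equivalence using () renaming (trans to ⇔-trans; sym to ⇔-sym)

indicator : Bool → ℕ
indicator b = if b then 1 else 0

count-+-cong : ∀ {k} (p q r s : Fin k → Bool) →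
  (∀ i → indicator (p i) + indicator (q i) ≡ indicator (r i) + indicator (s i)) →
  count p + count q ≡ count r + count s
count-+-cong {zero}  p q r s eq = refl
count-+-cong {suc k} p q r s eq = begin
  (indicator (p zero) + count (tail p)) + (indicator (q zero) + count (tail q))
    ≡⟨ interchange (indicator (p zero)) (count (tail p)) (indicator (q zero)) (count (tail q)) ⟩
  (indicator (p zero) + indicator (q zero)) + (count (tail p) + count (tail q))
    ≡⟨ cong₂ _+_ (eq zero) (count-+-cong (tail p) (tail q) (tail r) (tail s) (λ i → eq (suc i))) ⟩
  (indicator (r zero) + indicator (s zero)) + (count (tail r) + count (tail s))
    ≡⟨ interchange (indicator (r zero)) (indicator (s zero)) (count (tail r)) (count (tail s)) ⟩
  (indicator (r zero) + count (tail r)) + (indicator (s zero) + count (tail s)) ∎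
  where open ≡-Reasoning

count>0⇒∃ : ∀ {k} (p : Fin k → Bool) → 0 < count p → ∃ λ i → p i ≡ true
count>0⇒∃ {suc k} p count>0 with p zero in pzero
... | true  = zero , pzero
... | false with count>0⇒∃ (tail p) count>0
...   | i , pi = suc i , pi

∣tabulate∣≡count : ∀ {k} (p : Fin k → Bool) → ∣ tabulate p ∣ ≡ count p
∣tabulate∣≡count {zero}  p = refl
∣tabulate∣≡count {suc k} p with p zero
... | true  = cong suc (∣tabulate∣≡count (tail p))
... | false = ∣tabulate∣≡count (tail p)

∉tabulate⇒false : ∀ {k} (p : Fin k → Bool) i → i ∉ tabulate p → p i ≡ false
∉tabulate⇒false p i i∉ with p i in pi
... | false = refl
... | true  = ⊥-elim (i∉ (lookup⇒[]= i (tabulate p) (trans (lookup∘tabulate p i) pi)))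

-- Two clusters from a two-colouring c. The labels must be vertices, so the
-- endpoints of an edge that c splits serve as the two labels.
module TwoClusters {N : ℕ} (c : Fin N → Bool) {u w : Fin N} (split : c u xor c w ≡ true) where

  label : Fin N → Fin N
  label v = if c v xor c u then w else u

  u≢w : ¬ u ≡ w
  u≢w u≡w with trans (sym (xor-same (c u))) (subst (λ v → c u xor c v ≡ true) (sym u≡w) split)
  ... | ()

  label-≡⇔ : ∀ a b → (label a ≡ label b) ⇔ (c a xor c b ≡ false)
  label-≡⇔ a b = mk⇔ (to (c a) (c b) (c u)) (from (c a) (c b) (c u))
    where
    to : ∀ x y z → (if x xor z then w else u) ≡ (if y xor z then w else u) → x xor y ≡ false
    to true  true  z     eq = refl
    to false false z     eq = refl
    to true  false true  eq = ⊥-elim (u≢w eq)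
    to true  false false eq = ⊥-elim (u≢w (sym eq))
    to false true  true  eq = ⊥-elim (u≢w (sym eq))
    to false true  false eq = ⊥-elim (u≢w eq)
    from : ∀ x y z → x xor y ≡ false → (if x xor z then w else u) ≡ (if y xor z then w else u)
    from true  true  z refl = refl
    from false false z refl = refl

nonviolating-sign : ∀ b s → (if b then isPos s else isNeg s) ≡ false → (s ≡ pos ⇔ b ≡ false)
nonviolating-sign true  neg _ = mk⇔ (λ ()) (λ ())
nonviolating-sign false pos _ = mk⇔ (λ _ → refl) (λ _ → refl)

module _ (Σ : SignedGraph) (X : Subset (n Σ)) where

  violatesCut : Fin (m Σ) → Bool
  violatesCut e = if inCut Σ X e then isPos (sign Σ e) else isNeg (sign Σ e)

  cutViolators : Subset (m Σ)
  cutViolators = tabulate violatesCut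

  ∣cutViolators∣+negInCut≡numNeg+posInCut :
    ∣ cutViolators ∣ + negInCut Σ X ≡ numNeg Σ + posInCut Σ X
  ∣cutViolators∣+negInCut≡numNeg+posInCut =
    trans (cong (_+ negInCut Σ X) (∣tabulate∣≡count violatesCut))
          (count-+-cong _ _ _ _ pointwise)
    where
    pointwise : ∀ e →
      indicator (violatesCut e) + indicator (if inCut Σ X e then isNeg (sign Σ e) else false)
      ≡ indicator (isNeg (sign Σ e)) + indicator (if inCut Σ X e then isPos (sign Σ e) else false)
    pointwise e with inCut Σ X e | sign Σ e
    ... | true  | pos = refl
    ... | true  | neg = refl
    ... | false | pos = refl
    ... | false | neg = refl

  ∣cutViolators∣<numNeg : posInCut Σ X < negInCut Σ X → ∣ cutViolators ∣ < numNeg Σ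
  ∣cutViolators∣<numNeg pos<neg =
    +-cancelʳ-< (negInCut Σ X) ∣ cutViolators ∣ (numNeg Σ)
      (subst (_< numNeg Σ + negInCut Σ X)
             (sym ∣cutViolators∣+negInCut≡numNeg+posInCut)
             (+-monoʳ-< (numNeg Σ) pos<neg))

  negInCut>0⇒cutEdge : 0 < negInCut Σ X → ∃ λ e → inCut Σ X e ≡ true
  negInCut>0⇒cutEdge neg>0 with count>0⇒∃ _ neg>0
  ... | e , negCut = e , inCutOf (inCut Σ X e) negCut
    where
    inCutOf : ∀ b → (if b then isNeg (sign Σ e) else false) ≡ true → b ≡ true
    inCutOf true _ = refl

  clusterable-after-deleting-cutViolators :
    ∀ {e₀} → inCut Σ X e₀ ≡ true → ClusterableAfterDeleting Σ cutViolators
  clusterable-after-deleting-cutViolators e₀∈∂X = label , keeps-sign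
    where
    open TwoClusters (lookup X) e₀∈∂X
    keeps-sign : ∀ e → e ∉ cutViolators →
      (sign Σ e ≡ pos ⇔ label (proj₁ (ends Σ e)) ≡ label (proj₂ (ends Σ e)))
    keeps-sign e e∉ =
      ⇔-trans (nonviolating-sign _ _ (∉tabulate⇒false violatesCut e e∉))
              (⇔-sym (label-≡⇔ (proj₁ (ends Σ e)) (proj₂ (ends Σ e))))

lemma10p6 : (Σ : SignedGraph) (X : Subset (n Σ)) →
    posInCut Σ X < negInCut Σ X →
    (q : ℕ) → IsInclusterabilityIndex Σ q → q < numNeg Σ
lemma10p6 Σ X pos<neg q (_ , minimal) =
  ≤-<-trans (minimal (cutViolators Σ X) clusterable) (∣cutViolators∣<numNeg Σ X pos<neg)
  where
  clusterable : ClusterableAfterDeleting Σ (cutViolators Σ X)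
  clusterable = clusterable-after-deleting-cutViolators Σ X
    (proj₂ (negInCut>0⇒cutEdge Σ X (≤-<-trans z≤n pos<neg)))
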